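{- If a graph $G$ has a GS ordering whose $\mathcal{F}$-tree has at most $k$ leaves, then the pathwidth of $G$ is at most $k$. This bound is tight: for every $k\ge 1$ there is a graph having a GS ordering whose $\mathcal{F}$-tree has at most $k$ leaves and whose pathwidth is exactly $k$.
   Context: All graphs are finite, simple, undirected, connected and non-empty. A GS ordering of $G$ is an ordering $(v_1,\dots,v_n)$ of all vertices in which every $v_i$ with $i>1$ is adjacent to some $v_j$ with $j<i$. The $\mathcal{F}$-tree of $\sigma=(v_1,\dots,v_n)$ is the spanning tree rooted at $v_1$ in which, for $i>1$, the parent of $v_i$ is its leftmost neighbor in $\sigma$. A leaf is a vertex with no children; the root is never counted as a leaf. -}

module Defs where

open import Data.Nat using (ℕ; zero; suc; _≤_; _<_; _<ᵇ_; _≡ᵇ_)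
open import Data.Bool using (Bool; true; false; T; not; _∧_; _∨_)
open import Data.Fin using (Fin; toℕ)
open import Data.Fin.Subset using (Subset; _∈_; ∣_∣)
open import Data.Fin.Permutation using (Permutation′; _⟨$⟩ʳ_)
open import Data.List using (List; allFin)
open import Data.Bool.ListAction using (all; any)
open import Data.Empty using (⊥)
open import Data.Product using (Σ; ∃; _×_)
open import Relation.Binary.PropositionalEquality using (_≡_)

data Reachable {n : ℕ} (adj : Fin n → Fin n → Bool) : Fin n → Fin n → Set where
  here : ∀ {v} → Reachable adj v v
  step : ∀ {u w v} → T (adj u w) → Reachable adj w v → Reachable adj u v

record Graph : Set where
  field
    n         : ℕ
    adj       : Fin n → Fin n → Bool
    adj-sym   : ∀ u v → adj u v ≡ adj v u
    irrefl    : ∀ v → adj v v ≡ false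
    nonempty  : 1 ≤ n
    connected : ∀ u v → Reachable adj u v
open Graph public

-- An ordering of all vertices: position i ↦ vertex σ ⟨$⟩ʳ i (a bijection).
Ordering : Graph → Set
Ordering G = Permutation′ (n G)

adjPos : (G : Graph) → Ordering G → Fin (n G) → Fin (n G) → Bool
adjPos G σ i j = adj G (σ ⟨$⟩ʳ i) (σ ⟨$⟩ʳ j)

-- GS ordering: every v_i with i > 1 (0-based: i ≠ 0) has a neighbor v_j with j < i.
IsGS : (G : Graph) → Ordering G → Set
IsGS G σ = ∀ (i : Fin (n G)) → (toℕ i ≡ 0 → ⊥) →
             ∃ λ (j : Fin (n G)) → (toℕ j < toℕ i) × T (adjPos G σ i j)

-- In the F-tree of σ, v_j is the parent of v_i iff j < i and v_j is the
-- leftmost neighbour of v_i in σ.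
isParent : (G : Graph) → Ordering G → (j i : Fin (n G)) → Bool
isParent G σ j i =
  (toℕ j <ᵇ toℕ i) ∧ adjPos G σ i j ∧
  all (λ j′ → not (toℕ j′ <ᵇ toℕ j) ∨ not (adjPos G σ i j′)) (allFin (n G))

isLeaf : (G : Graph) → Ordering G → Fin (n G) → Bool
isLeaf G σ j = not (toℕ j ≡ᵇ 0) ∧ not (any (isParent G σ j) (allFin (n G)))

countTrue : {A : Set} → (A → Bool) → List A → ℕ
countTrue p List.[] = 0
countTrue p (x List.∷ xs) with p x
... | true  = suc (countTrue p xs)
... | false = countTrue p xs

leafCount : (G : Graph) → Ordering G → ℕ
leafCount G σ = countTrue (isLeaf G σ) (allFin (n G))

record PathDecomposition (G : Graph) : Set where
  field
    len    : ℕ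
    bag    : Fin len → Subset (n G)
    cover  : ∀ v → ∃ λ i → v ∈ bag i
    edges  : ∀ u v → T (adj G u v) → ∃ λ i → (u ∈ bag i) × (v ∈ bag i)
    contig : ∀ (a b c : Fin len) v → toℕ a ≤ toℕ b → toℕ b ≤ toℕ c →
             v ∈ bag a → v ∈ bag c → v ∈ bag b
open PathDecomposition public

WidthAtMost : {G : Graph} → PathDecomposition G → ℕ → Set
WidthAtMost P k = ∀ i → ∣ bag P i ∣ ≤ suc k

PathwidthAtMost : Graph → ℕ → Set
PathwidthAtMost G k = Σ (PathDecomposition G) λ P → WidthAtMost P k

-- Let parent(p) be the leftmost neighbour of the vertex at position p, and give
-- each vertex at position p the interval [parent(p), p].  The later endpoint of
-- an edge reaches back to the earlier one, so these intervals form a path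
-- decomposition.  Its bag at t holds the vertex at t and the vertices whose
-- F-tree edge to their parent crosses t.  Going down the F-tree from each of the
-- latter reaches a leaf, and these leaves are distinct because positions
-- decrease strictly towards the root, so a root path crosses t only once.
-- For tightness, in K(k+1) some bag contains the whole clique (Helly property
-- of intervals), while its F-tree under any ordering is a star with k leaves.

module Submission where

open import Defs
open import Data.Nat using (ℕ; zero; suc; _≤_; _<_; _∸_; z≤n; s≤s; _≡ᵇ_)
import Data.Nat as ℕ
open import Data.Nat.Properties
  using (≤-refl; ≤-trans; ≤-reflexive; <⇒≤; <-≤-trans; <⇒≱; ≮⇒≥; ≤-antisym;
         ≤∧≢⇒<; ≰⇒>; m≤n⇒m≤1+n; m<n⇒0<n; ≤-pred; <ᵇ⇒<; <⇒<ᵇ; <-cmp; module ≤-Reasoning)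
open import Data.Bool using (Bool; true; false; T; not; _∨_)
open import Data.Bool.Properties using (T-≡; T-∧; T?)
open import Data.Bool.ListAction using (any)
open import Data.Unit using (tt)
open import Data.Empty using (⊥-elim)
open import Data.Fin using (Fin; zero; suc; toℕ; _>_)
import Data.Fin as Fin
open import Data.Fin.Properties using (_≟_; toℕ-injective; suc-injective; 0≢1+n; any?)
open import Data.Fin.Induction using (>-wellFounded)
open import Data.Fin.Subset using (Subset; _∈_; ∣_∣; _-_; ⊤)
open import Data.Fin.Subset.Properties
  using (_∈?_; x∈p∧x∉q⇒x∈p─q; x∈p⇒∣p-x∣<∣p∣; x∈⁅y⁆⇒x≡y; ∣⊤∣≡n; p⊆q⇒∣p∣≤∣q∣)
open import Data.Fin.Permutation using (_⟨$⟩ʳ_; _⟨$⟩ˡ_; inverseʳ)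
import Data.Fin.Permutation as Permutation
open import Data.Vec.Base using ([]; _∷_; tabulate; here; there)
open import Data.Vec.Properties using (lookup∘tabulate; lookup⇒[]=; []=⇒lookup)
import Data.List.Base as List
open import Data.List.Properties using (length-tabulate)
open import Data.List.Relation.Unary.Any using (satisfied)
open import Data.List.Relation.Unary.Any.Properties using (any⁻)
open import Data.List.Relation.Unary.All.Properties using (all⁺; tabulate⁻)
open import Data.Product using (Σ; ∃; _×_; _,_; proj₁; proj₂)
open import Data.Sum using (_⊎_; inj₁; inj₂)
open import Function using (_∘_; id)
open import Function.Bundles using (Equivalence)
open import Induction.WellFounded using (Acc; acc)
open import Relation.Binary.Construct.Closure.ReflexiveTransitive using (Star; ε; _◅_; _◅◅_)
open import Relation.Binary.Definitions using (tri<; tri≈; tri>)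
open import Relation.Binary.PropositionalEquality
  using (_≡_; _≢_; refl; sym; trans; cong; cong₂; subst)
open import Relation.Nullary using (¬_; Dec; yes; no)
open import Relation.Nullary.Decidable using (isYes; toWitness; fromWitness; _×-dec_)
open import Relation.Unary using (Pred; Decidable)

T-nand : ∀ {a b} → T (not a ∨ not b) → T a → ¬ T b
T-nand {true}  {true}  ()
T-nand {true}  {false} _ _ ()
T-nand {false}         _ ()

T-not : ∀ {b} → ¬ T b → T (not b)
T-not {false} _  = tt
T-not {true}  ¬b = ¬b tt

∈-tabulate⁺ : ∀ {m} (f : Fin m → Bool) {x} → T (f x) → x ∈ tabulate f
∈-tabulate⁺ f {x} fx =
  lookup⇒[]= x (tabulate f) (trans (lookup∘tabulate f x) (Equivalence.to T-≡ fx))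

∈-tabulate⁻ : ∀ {m} (f : Fin m → Bool) {x} → x ∈ tabulate f → T (f x)
∈-tabulate⁻ f {x} x∈ =
  Equivalence.from T-≡ (trans (sym (lookup∘tabulate f x)) ([]=⇒lookup x∈))

∣tabulate∣≡countTrue : ∀ {A : Set} {m} (p : A → Bool) (f : Fin m → A) →
                       ∣ tabulate (p ∘ f) ∣ ≡ countTrue p (List.tabulate f)
∣tabulate∣≡countTrue {m = zero}  p f = refl
∣tabulate∣≡countTrue {m = suc m} p f with p (f zero)
... | true  = cong suc (∣tabulate∣≡countTrue p (f ∘ suc))
... | false = ∣tabulate∣≡countTrue p (f ∘ suc)

countTrue≤length : ∀ {A : Set} (p : A → Bool) xs → countTrue p xs ≤ List.length xs
countTrue≤length p List.[] = z≤n
countTrue≤length p (x List.∷ xs) with p x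
... | true  = s≤s (countTrue≤length p xs)
... | false = m≤n⇒m≤1+n (countTrue≤length p xs)

∣p∣≤∣q∣-injection : ∀ {m n} {p : Subset m} {q : Subset n} (f : Fin m → Fin n) →
                    (∀ {x} → x ∈ p → f x ∈ q) →
                    (∀ {x y} → x ∈ p → y ∈ p → f x ≡ f y → x ≡ y) →
                    ∣ p ∣ ≤ ∣ q ∣
∣p∣≤∣q∣-injection {p = []} f _ _ = z≤n
∣p∣≤∣q∣-injection {p = false ∷ p} f f∈ f-inj =
  ∣p∣≤∣q∣-injection (f ∘ suc) (f∈ ∘ there)
    (λ x∈ y∈ e → suc-injective (f-inj (there x∈) (there y∈) e))
∣p∣≤∣q∣-injection {p = true ∷ p} {q} f f∈ f-inj =
  ≤-trans (s≤s rest) (x∈p⇒∣p-x∣<∣p∣ (f∈ here))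
  where
  rest : ∣ p ∣ ≤ ∣ q - f zero ∣
  rest = ∣p∣≤∣q∣-injection (f ∘ suc)
    (λ x∈ → x∈p∧x∉q⇒x∈p─q (f∈ (there x∈))
              (λ fx∈ → 0≢1+n (f-inj here (there x∈) (sym (x∈⁅y⁆⇒x≡y _ fx∈)))))
    (λ x∈ y∈ e → suc-injective (f-inj (there x∈) (there y∈) e))

Least : ∀ {m ℓ} → Pred (Fin m) ℓ → Set ℓ
Least {m} P = Σ (Fin m) λ i → P i × (∀ j → toℕ j < toℕ i → ¬ P j)

least : ∀ {m ℓ} {P : Pred (Fin m) ℓ} → Decidable P → ∃ P → Least P
least {suc m} P? w with P? zero
... | yes P0 = zero , P0 , λ _ ()
... | no ¬P0 with w
...   | zero  , P0 = ⊥-elim (¬P0 P0)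
...   | suc i , Pi with least (P? ∘ suc) (i , Pi)
...     | j , Pj , minimal =
  suc j , Pj , λ { zero _ → ¬P0 ; (suc j′) (s≤s j′<j) → minimal j′ j′<j }

argmax : ∀ {m} (g : Fin (suc m) → ℕ) → Σ (Fin (suc m)) λ x → ∀ y → g y ≤ g x
argmax {zero}  g = zero , λ { zero → ≤-refl }
argmax {suc m} g with argmax (g ∘ suc)
... | x , max with g zero ℕ.≤? g (suc x)
...   | yes g0≤ = suc x , λ { zero → g0≤ ; (suc y) → max y }
...   | no g0≰  = zero , λ { zero → ≤-refl ; (suc y) → ≤-trans (max y) (<⇒≤ (≰⇒> g0≰)) }

module Intervals (G : Graph) {len : ℕ} (lo hi : Fin (n G) → Fin len) where

  InInterval : Fin len → Fin (n G) → Set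
  InInterval i v = toℕ (lo v) ≤ toℕ i × toℕ i ≤ toℕ (hi v)

  inInterval? : ∀ i v → Dec (InInterval i v)
  inInterval? i v = (toℕ (lo v) ℕ.≤? toℕ i) ×-dec (toℕ i ℕ.≤? toℕ (hi v))

  intervalBag : Fin len → Subset (n G)
  intervalBag i = tabulate (λ v → isYes (inInterval? i v))

  ∈intervalBag⁺ : ∀ {i v} → InInterval i v → v ∈ intervalBag i
  ∈intervalBag⁺ {i} v∈ = ∈-tabulate⁺ (λ v → isYes (inInterval? i v)) (fromWitness v∈)

  ∈intervalBag⁻ : ∀ {i v} → v ∈ intervalBag i → InInterval i v
  ∈intervalBag⁻ {i} v∈ = toWitness (∈-tabulate⁻ (λ v → isYes (inInterval? i v)) v∈)

  intervalDecomposition : (∀ v → toℕ (lo v) ≤ toℕ (hi v)) →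
                          (∀ u v → T (adj G u v) → ∃ λ i → InInterval i u × InInterval i v) →
                          PathDecomposition G
  intervalDecomposition lo≤hi edgesMeet = record
    { len    = len
    ; bag    = intervalBag
    ; cover  = λ v → lo v , ∈intervalBag⁺ (≤-refl , lo≤hi v)
    ; edges  = λ u v uv → let (i , u∈ , v∈) = edgesMeet u v uv
                          in i , ∈intervalBag⁺ u∈ , ∈intervalBag⁺ v∈
    ; contig = λ a b c v a≤b b≤c v∈a v∈c →
        ∈intervalBag⁺ ( ≤-trans (proj₁ (∈intervalBag⁻ v∈a)) a≤b
                      , ≤-trans b≤c (proj₂ (∈intervalBag⁻ v∈c)))
    }

module FTree (G : Graph) (σ : Ordering G) where

  N : ℕ
  N = n G

  -- Making a position with no earlier neighbour its own parent keeps the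
  -- parent function total; under a GS ordering this happens only at the root.
  ParentCandidate : Fin N → Fin N → Set
  ParentCandidate i j = (toℕ j < toℕ i × T (adjPos G σ i j)) ⊎ j ≡ i

  parentCandidate? : ∀ i → Decidable (ParentCandidate i)
  parentCandidate? i j with (toℕ j ℕ.<? toℕ i) ×-dec T? (adjPos G σ i j) | j ≟ i
  ... | yes earlier | _      = yes (inj₁ earlier)
  ... | no _        | yes ji = yes (inj₂ ji)
  ... | no ¬earlier | no j≢i = no λ { (inj₁ earlier) → ¬earlier earlier ; (inj₂ ji) → j≢i ji }

  leastParentCandidate : ∀ i → Least (ParentCandidate i)
  leastParentCandidate i = least (parentCandidate? i) (i , inj₂ refl)

  parent : Fin N → Fin N
  parent i = proj₁ (leastParentCandidate i)

  parent-candidate : ∀ i → ParentCandidate i (parent i)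
  parent-candidate i = proj₁ (proj₂ (leastParentCandidate i))

  parent-minimal : ∀ i j → toℕ j < toℕ (parent i) → ¬ ParentCandidate i j
  parent-minimal i = proj₂ (proj₂ (leastParentCandidate i))

  parent≤ : ∀ i → toℕ (parent i) ≤ toℕ i
  parent≤ i = ≮⇒≥ λ i<p → parent-minimal i i i<p (inj₂ refl)

  parent-leftmost : ∀ {i j} → toℕ j < toℕ i → T (adjPos G σ i j) → toℕ (parent i) ≤ toℕ j
  parent-leftmost {i} j<i ij = ≮⇒≥ λ j<p → parent-minimal i _ j<p (inj₁ (j<i , ij))

  isParent⇒ : ∀ {j i} → T (isParent G σ j i) →
              toℕ j < toℕ i × T (adjPos G σ i j) ×
              (∀ j′ → toℕ j′ < toℕ j → ¬ T (adjPos G σ i j′))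
  isParent⇒ {j} {i} h =
    let (j<ᵇi , rest) = Equivalence.to T-∧ h
        (ij , leftmost) = Equivalence.to (T-∧ {adjPos G σ i j}) rest
    in <ᵇ⇒< _ _ j<ᵇi , ij ,
       λ j′ j′<j → T-nand (tabulate⁻ (all⁺ _ (List.allFin N) leftmost) j′)
                          (<⇒<ᵇ j′<j)

  isParent⇒parent≡ : ∀ {j i} → T (isParent G σ j i) → parent i ≡ j
  isParent⇒parent≡ {j} {i} h = toℕ-injective (≤-antisym (parent-leftmost j<i ij) j≤p)
    where
    j<i = proj₁ (isParent⇒ h)
    ij = proj₁ (proj₂ (isParent⇒ h))
    j≤p : toℕ j ≤ toℕ (parent i)
    j≤p with parent-candidate i
    ... | inj₁ (_ , ip) = ≮⇒≥ λ p<j → proj₂ (proj₂ (isParent⇒ h)) (parent i) p<j ip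
    ... | inj₂ p≡i      = subst (λ p → toℕ j ≤ toℕ p) (sym p≡i) (<⇒≤ j<i)

  Descendant : Fin N → Fin N → Set
  Descendant = Star (λ d p → parent d ≡ p)

  descendant⇒≥ : ∀ {d p} → Descendant d p → toℕ p ≤ toℕ d
  descendant⇒≥ ε          = ≤-refl
  descendant⇒≥ (refl ◅ r) = ≤-trans (descendant⇒≥ r) (parent≤ _)

  Childless : Fin N → Set
  Childless w = ∀ c → ¬ T (isParent G σ w c)

  childlessBelow : ∀ p → Σ (Fin N) λ w → Descendant w p × Childless w
  childlessBelow p = go p (>-wellFounded p)
    where
    go : ∀ p → Acc _>_ p → Σ (Fin N) λ w → Descendant w p × Childless w
    go p (acc rs) with any? (λ c → T? (isParent G σ p c))
    ... | no noChild = p , ε , λ c pc → noChild (c , pc)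
    ... | yes (c , pc) =
      let (w , w⊑c , childless) = go c (rs (proj₁ (isParent⇒ pc)))
      in w , w⊑c ◅◅ (isParent⇒parent≡ pc ◅ ε) , childless

  childless⇒isLeaf : ∀ {w} → 0 < toℕ w → Childless w → T (isLeaf G σ w)
  childless⇒isLeaf {w} 0<w childless = Equivalence.from T-∧ (notRoot (toℕ w) 0<w , T-not noChild)
    where
    notRoot : ∀ m → 0 < m → T (not (m ≡ᵇ 0))
    notRoot (suc m) _ = tt
    noChild : ¬ T (any (isParent G σ w) (List.allFin N))
    noChild h = let (c , pc) = satisfied (any⁻ (isParent G σ w) (List.allFin N) h) in childless c pc

  Crosses : Fin N → Fin N → Set
  Crosses t p = toℕ (parent p) ≤ toℕ t × toℕ t < toℕ p

  crossing-unique : ∀ {t d p q} → Descendant d p → Descendant d q →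
                    Crosses t p → Crosses t q → p ≡ q
  crossing-unique ε          ε          _            _            = refl
  crossing-unique ε          (refl ◅ r) (pd≤t , _)   (_ , t<q)    = ⊥-elim (<⇒≱ t<q (≤-trans (descendant⇒≥ r) pd≤t))
  crossing-unique (refl ◅ r) ε          (_ , t<p)    (pd≤t , _)   = ⊥-elim (<⇒≱ t<p (≤-trans (descendant⇒≥ r) pd≤t))
  crossing-unique (refl ◅ r) (refl ◅ s) crossesP     crossesQ     = crossing-unique r s crossesP crossesQ

  pos : Fin N → Fin N
  pos u = σ ⟨$⟩ˡ u

  pos-injective : ∀ {u v} → pos u ≡ pos v → u ≡ v
  pos-injective e = trans (sym (inverseʳ σ)) (trans (cong (σ ⟨$⟩ʳ_) e) (inverseʳ σ))

  adjPos-pos : ∀ u v → adjPos G σ (pos u) (pos v) ≡ adj G u v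
  adjPos-pos u v = cong₂ (adj G) (inverseʳ σ) (inverseʳ σ)

  open Intervals G (parent ∘ pos) pos

  meetAtEarlierEndpoint : ∀ {u v} → T (adj G u v) → toℕ (pos u) < toℕ (pos v) →
                          InInterval (pos u) u × InInterval (pos u) v
  meetAtEarlierEndpoint {u} {v} uv u<v =
    (parent≤ (pos u) , ≤-refl) ,
    (parent-leftmost u<v (subst T (sym (trans (adjPos-pos v u) (adj-sym G v u))) uv) , <⇒≤ u<v)

  edgesMeet : ∀ u v → T (adj G u v) → ∃ λ i → InInterval i u × InInterval i v
  edgesMeet u v uv with <-cmp (toℕ (pos u)) (toℕ (pos v))
  ... | tri< u<v _ _ = pos u , meetAtEarlierEndpoint uv u<v
  ... | tri> _ _ v<u = let (v∈ , u∈) = meetAtEarlierEndpoint (subst T (adj-sym G u v) uv) v<u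
                       in pos v , u∈ , v∈
  ... | tri≈ _ u≡v _ =
    ⊥-elim (subst T (trans (cong (adj G u) (sym (pos-injective (toℕ-injective u≡v)))) (irrefl G u)) uv)

  decomposition : PathDecomposition G
  decomposition = intervalDecomposition (parent≤ ∘ pos) edgesMeet

  Spans : Fin N → Fin N → Set
  Spans t p = toℕ (parent p) ≤ toℕ t × toℕ t ≤ toℕ p

  spans⇒crosses : ∀ {t p} → Spans t p → p ≢ t → Crosses t p
  spans⇒crosses (p≤t , t≤p) p≢t = p≤t , ≤∧≢⇒< t≤p (λ e → p≢t (toℕ-injective (sym e)))

  leaves : Subset N
  leaves = tabulate (isLeaf G σ)

  -- The bag at t is charged to t itself and to one leaf per tree edge crossing t.
  label : Fin N → Fin N → Fin (suc N)
  label t p with p ≟ t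
  ... | yes _ = zero
  ... | no _  = suc (proj₁ (childlessBelow p))

  label-∈ : ∀ {t p} → Spans t p → label t p ∈ (true ∷ leaves)
  label-∈ {t} {p} spans with p ≟ t
  ... | yes _   = here
  ... | no p≢t  =
    let (w , w⊑p , childless) = childlessBelow p
        t<p = proj₂ (spans⇒crosses spans p≢t)
    in there (∈-tabulate⁺ (isLeaf G σ)
               (childless⇒isLeaf (<-≤-trans (m<n⇒0<n t<p) (descendant⇒≥ w⊑p)) childless))

  label-injective : ∀ {t p q} → Spans t p → Spans t q → label t p ≡ label t q → p ≡ q
  label-injective {t} {p} {q} spansP spansQ e with p ≟ t | q ≟ t
  ... | yes p≡t | yes q≡t = trans p≡t (sym q≡t)
  ... | yes _   | no _    = ⊥-elim (0≢1+n e)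
  ... | no _    | yes _   = ⊥-elim (0≢1+n (sym e))
  ... | no p≢t  | no q≢t  =
    crossing-unique (proj₁ (proj₂ (childlessBelow p)))
      (subst (λ w → Descendant w q) (sym (suc-injective e)) (proj₁ (proj₂ (childlessBelow q))))
      (spans⇒crosses spansP p≢t) (spans⇒crosses spansQ q≢t)

  bag-size : ∀ t → ∣ intervalBag t ∣ ≤ suc (leafCount G σ)
  bag-size t = begin
    ∣ intervalBag t ∣    ≤⟨ ∣p∣≤∣q∣-injection (label t ∘ pos)
                              (λ v∈ → label-∈ (∈intervalBag⁻ v∈))
                              (λ u∈ v∈ e → pos-injective
                                 (label-injective (∈intervalBag⁻ u∈) (∈intervalBag⁻ v∈) e)) ⟩
    ∣ true ∷ leaves ∣    ≡⟨ cong suc (∣tabulate∣≡countTrue (isLeaf G σ) id) ⟩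
    suc (leafCount G σ)  ∎
    where open ≤-Reasoning

pathwidth≤leafCount : (G : Graph) (σ : Ordering G) → PathwidthAtMost G (leafCount G σ)
pathwidth≤leafCount G σ = decomposition , bag-size
  where open FTree G σ

pathwidth-mono : ∀ {G k l} → k ≤ l → PathwidthAtMost G k → PathwidthAtMost G l
pathwidth-mono k≤l (P , width) = P , λ i → ≤-trans (width i) (s≤s k≤l)

distinct : ∀ {m} → Fin m → Fin m → Bool
distinct u v = not (isYes (u ≟ v))

distinct-sym : ∀ {m} (u v : Fin m) → distinct u v ≡ distinct v u
distinct-sym u v with u ≟ v | v ≟ u
... | yes _   | yes _   = refl
... | no _    | no _    = refl
... | yes u≡v | no v≢u  = ⊥-elim (v≢u (sym u≡v))
... | no u≢v  | yes v≡u = ⊥-elim (u≢v (sym v≡u))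

distinct-irrefl : ∀ {m} (v : Fin m) → distinct v v ≡ false
distinct-irrefl v with v ≟ v
... | yes _  = refl
... | no v≢v = ⊥-elim (v≢v refl)

≢⇒distinct : ∀ {m} {u v : Fin m} → u ≢ v → T (distinct u v)
≢⇒distinct {u = u} {v} u≢v with u ≟ v
... | yes u≡v = u≢v u≡v
... | no _    = tt

complete : ℕ → Graph
complete k = record
  { n         = suc k
  ; adj       = distinct
  ; adj-sym   = distinct-sym
  ; irrefl    = distinct-irrefl
  ; nonempty  = s≤s z≤n
  ; connected = reach
  }
  where
  reach : (u v : Fin (suc k)) → Reachable distinct u v
  reach u v with u ≟ v
  ... | yes refl = here
  ... | no u≢v   = step (≢⇒distinct u≢v) here

complete-isGS : ∀ k → IsGS (complete k) Permutation.id
complete-isGS k zero    0≢0 = ⊥-elim (0≢0 refl)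
complete-isGS k (suc i) _   = zero , s≤s z≤n , tt

-- Position 0 is never a leaf, so the count runs over the remaining k positions only.
complete-leafCount : ∀ k → leafCount (complete k) Permutation.id ≤ k
complete-leafCount k =
  ≤-trans (countTrue≤length (isLeaf (complete k) Permutation.id) (List.tabulate Fin.suc))
          (≤-reflexive (length-tabulate {n = k} Fin.suc))

-- Helly property for intervals: the vertex whose interval starts last lies in every other interval.
complete-fullBag : ∀ {k} (P : PathDecomposition (complete k)) → ∃ λ i → ∀ v → v ∈ bag P i
complete-fullBag {k} P = first last , contains
  where
  firstBag : ∀ v → Least (λ i → v ∈ bag P i)
  firstBag v = least (λ i → v ∈? bag P i) (cover P v)

  first : Fin (suc k) → Fin (len P)
  first v = proj₁ (firstBag v)

  last : Fin (suc k)
  last = proj₁ (argmax (toℕ ∘ first))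

  first≤ : ∀ v i → v ∈ bag P i → toℕ (first v) ≤ toℕ i
  first≤ v i v∈ = ≮⇒≥ λ i<f → proj₂ (proj₂ (firstBag v)) i i<f v∈

  contains : ∀ v → v ∈ bag P (first last)
  contains v with v ≟ last
  ... | yes refl = proj₁ (proj₂ (firstBag v))
  ... | no v≢last =
    let (i , v∈ , last∈) = edges P v last (≢⇒distinct v≢last)
    in contig P (first v) (first last) i v
         (proj₂ (argmax (toℕ ∘ first)) v) (first≤ last i last∈) (proj₁ (proj₂ (firstBag v))) v∈

complete-¬pathwidth : ∀ {k l} → l < k → ¬ PathwidthAtMost (complete k) l
complete-¬pathwidth {k} {l} l<k (P , width) = <⇒≱ l<k (≤-pred (begin
  suc k            ≡⟨ sym (∣⊤∣≡n (suc k)) ⟩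
  ∣ ⊤ {suc k} ∣    ≤⟨ p⊆q⇒∣p∣≤∣q∣ {p = ⊤} {q = bag P i} (λ {v} _ → proj₂ (complete-fullBag P) v) ⟩
  ∣ bag P i ∣      ≤⟨ width i ⟩
  suc l            ∎))
  where
  open ≤-Reasoning
  i = proj₁ (complete-fullBag P)

lemma3p8 :
    ((G : Graph) (σ : Ordering G) (k : ℕ) →
       IsGS G σ → leafCount G σ ≤ k → PathwidthAtMost G k)
    ×
    ((k : ℕ) → 1 ≤ k →
       Σ Graph λ G → Σ (Ordering G) λ σ →
         IsGS G σ × leafCount G σ ≤ k ×
         PathwidthAtMost G k × ¬ PathwidthAtMost G (k ∸ 1))
lemma3p8 = upperBound , tight
  where
  upperBound : (G : Graph) (σ : Ordering G) (k : ℕ) →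
               IsGS G σ → leafCount G σ ≤ k → PathwidthAtMost G k
  upperBound G σ k _ leaves≤k = pathwidth-mono leaves≤k (pathwidth≤leafCount G σ)

  tight : (k : ℕ) → 1 ≤ k →
          Σ Graph λ G → Σ (Ordering G) λ σ →
            IsGS G σ × leafCount G σ ≤ k ×
            PathwidthAtMost G k × ¬ PathwidthAtMost G (k ∸ 1)
  tight (suc k) _ =
    complete (suc k) , Permutation.id ,
    complete-isGS (suc k) , complete-leafCount (suc k) ,
    upperBound (complete (suc k)) Permutation.id (suc k)
      (complete-isGS (suc k)) (complete-leafCount (suc k)) ,
    complete-¬pathwidth ≤-refl
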